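{- Let $T_1$ and $T_2$ be trees. If $M_2(T_1)=M_2(T_2)$, then $M_1(T_1)=M_1(T_2)$.
   Context: For a tree $T$ and a subset $X\subseteq V(T)$, $\operatorname{int}(X)$ is the number of edges of $T$ with both endpoints in $X$, and $\operatorname{ext}(X)$ is the number of edges of $T$ with exactly one endpoint in $X$. For a nonnegative integer $i$, $M_i(T)$ denotes the multiset of pairs $(\operatorname{int}(X),\operatorname{ext}(X))$ over all subsets $X\subseteq V(T)$ with $|X|=i$. (In particular $M_1(T)$ is equivalent to the degree sequence of $T$.) -}

module Defs where

open import Data.Nat using (ℕ; zero; suc; _+_; _≤_; _≟_)
open import Data.Fin using (Fin; toℕ)
open import Data.Bool using (Bool; true; false; _∧_; _xor_; T; if_then_else_)
open import Data.Vec using (Vec; []; _∷_; lookup)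
open import Data.List using (List; []; _∷_; _++_; map; filter; sum; allFin; length; concatMap)
open import Data.List.Relation.Unary.Unique.Propositional using (Unique)
open import Data.Product using (_×_; _,_; ∃; Σ)
open import Data.Unit using (⊤)
open import Data.Fin.Subset using (Subset; ∣_∣)
import Data.Nat as ℕ
open import Relation.Binary.PropositionalEquality using (_≡_)

record Graph (n : ℕ) : Set where
  field
    adj    : Fin n → Fin n → Bool
    sym    : ∀ u v → adj u v ≡ adj v u
    irrefl : ∀ u → adj u u ≡ false
open Graph public

Adj : ∀ {n} → Graph n → Fin n → Fin n → Set
Adj G u v = T (adj G u v)

Chain : ∀ {n} → Graph n → List (Fin n) → Set
Chain G []            = ⊤
Chain G (x ∷ [])      = ⊤
Chain G (x ∷ y ∷ r)   = Adj G x y × Chain G (y ∷ r)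

Connected : ∀ {n} → Graph n → Set
Connected {n} G = ∀ (u v : Fin n) → ∃ λ (vs : List (Fin n)) → Chain G (u ∷ vs ++ v ∷ [])

HasCycle : ∀ {n} → Graph n → Set
HasCycle {n} G = ∃ λ (x : Fin n) → ∃ λ (rest : List (Fin n)) →
  Unique (x ∷ rest) × (2 ≤ length rest) × Chain G (x ∷ rest ++ x ∷ [])

Acyclic : ∀ {n} → Graph n → Set
Acyclic G = HasCycle G → Data.Empty.⊥
  where import Data.Empty

record IsTree {n : ℕ} (G : Graph n) : Set where
  field
    nonempty  : 1 ≤ n
    connected : Connected G
    acyclic   : Acyclic G

allSubsets : (n : ℕ) → List (Subset n)
allSubsets zero    = [] ∷ []
allSubsets (suc n) = map (false ∷_) (allSubsets n) ++ map (true ∷_) (allSubsets n)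

edges : ∀ {n} → Graph n → List (Fin n × Fin n)
edges {n} G = concatMap (λ u → concatMap (λ v →
  if (toℕ u ℕ.<ᵇ toℕ v) ∧ adj G u v then (u , v) ∷ [] else []) (allFin n)) (allFin n)

count : ∀ {A : Set} → (A → Bool) → List A → ℕ
count p xs = length (Data.List.filterᵇ p xs)

int : ∀ {n} → Graph n → Subset n → ℕ
int G X = count (λ e → lookup X (Data.Product.proj₁ e) ∧ lookup X (Data.Product.proj₂ e)) (edges G)

ext : ∀ {n} → Graph n → Subset n → ℕ
ext G X = count (λ e → lookup X (Data.Product.proj₁ e) xor lookup X (Data.Product.proj₂ e)) (edges G)

-- M_i(T) as a list, regarded as a multiset (compare up to permutation)
M : ∀ {n} → ℕ → Graph n → List (ℕ × ℕ)
M {n} i G = map (λ X → int G X , ext G X)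
  (Data.List.filterᵇ (λ X → ∣ X ∣ ℕ.≡ᵇ i) (allSubsets n))

{-# OPTIONS --safe #-}
-- Since every edge meeting X is counted once per endpoint in X, 2·int X + ext X is the sum of
-- the degrees of the vertices of X. Hence M₁(T) is the degree multiset D (paired with int = 0),
-- and M₂(T) determines the multiset of pairwise sums of D. A multiset of naturals is recovered
-- from its pairwise sums once its least element m is known: remove m and repeatedly take the
-- least sum not yet explained by the recovered elements; it is m plus the next smallest element.
-- In a tree every degree is at least 1 and the end of a maximal path is a leaf, so m = 1.
module Submission where

open import Defs hiding (sym)
import Data.Nat.Properties
open import Algebra.Properties.CommutativeMonoid.Sum Data.Nat.Properties.+-0-commutativeMonoid
  using (sum-syntax; sum-cong-≗; sum-replicate-zero; sum-remove; ∑-distrib-+; ∑-comm)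
open import Algebra.Properties.CommutativeSemigroup Data.Nat.Properties.+-commutativeSemigroup
  using (interchange)
open import Data.Bool using (Bool; true; false; _∧_; _∨_; _xor_; T; if_then_else_)
open import Data.Bool.Properties using (∧-zeroʳ; ∧-identityʳ)
open import Data.Empty using (⊥-elim)
open import Data.Fin using (Fin; zero; suc; toℕ; _≟_)
open import Data.Fin.Properties using (toℕ-injective; suc-injective; any?; injective⇒≤)
open import Data.Fin.Subset using (Subset; ⁅_⁆; _∪_; ∣_∣)
open import Data.Fin.Subset.Properties using (x∈⁅y⁆⇒x≡y; ∪-identityˡ)
open import Data.List using (List; []; _∷_; _++_; map; concatMap; tabulate; length; filterᵇ; allFin)
import Data.List as List
open import Data.List.Properties
  using (length-++; filter-++; filter-none; map-++; map-∘; map-tabulate; map-cong; map-cong-local)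
import Data.List.Properties as List
open import Data.List.Membership.Propositional using (_∈_; _∉_)
open import Data.List.Membership.Propositional.Properties
  using (∈-++⁺ʳ; ∈-∃++; ∈-lookup; ∈-map⁺; ∈-allFin)
open import Data.List.Relation.Unary.All as All using (All; []; _∷_)
import Data.List.Relation.Unary.All.Properties as All
open import Data.List.Relation.Unary.Any using (here; there)
open import Data.List.Relation.Unary.AllPairs using (AllPairs; []; _∷_)
open import Data.List.Relation.Unary.Linked.Properties using (Linked⇒AllPairs)
open import Data.List.Relation.Unary.Unique.Propositional using (Unique)
open import Data.List.Relation.Unary.Unique.Propositional.Properties using (allFin⁺)
open import Data.List.Relation.Binary.Permutation.Propositional hiding (trans)
import Data.List.Relation.Binary.Permutation.Propositional as ↭
open import Data.List.Relation.Binary.Permutation.Propositional.Properties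
open import Data.List.Sort Data.Nat.Properties.≤-decTotalOrder using (sort; sort-↭; sort-↗)
open import Data.Nat using (ℕ; zero; suc; _+_; _*_; _≤_; _<_; z≤n; s≤s; _<ᵇ_; _≡ᵇ_)
open import Data.Nat.Properties
  using ( +-comm; +-suc; +-identityʳ; *-distribˡ-+; +-mono-≤; +-monoˡ-≤; +-cancelˡ-≤; m≤m+n
        ; ≤-refl; ≤-reflexive; ≤-trans; ≤-antisym; <-irrefl; <-asym; ≮⇒≥; <ᵇ⇒<; <⇒<ᵇ)
open import Data.Product using (∃; _×_; _,_; proj₁; proj₂)
import Data.Product as Product
open import Data.Unit using (tt)
open import Data.Vec using (_∷_; lookup)
open import Data.Vec.Properties using (lookup-zipWith; lookup-replicate; lookup⇒[]=)
open import Function using (_∘_; id)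
open import Relation.Binary.PropositionalEquality
  using (_≡_; _≢_; refl; sym; trans; cong; cong₂; subst; module ≡-Reasoning)
open import Relation.Nullary using (¬_; yes; no; contradiction)
open import Relation.Nullary.Decidable using (T?; _×-dec_; ¬?)

-- Pairwise sums

pairwiseSums : List ℕ → List ℕ
pairwiseSums []       = []
pairwiseSums (x ∷ xs) = map (x +_) xs ++ pairwiseSums xs

crossSums : List ℕ → List ℕ → List ℕ
crossSums []       ys = []
crossSums (k ∷ ks) ys = map (k +_) ys ++ crossSums ks ys

-- The pairwise sums of ks ++ xs that are not pairwise sums of ks.
newSums : List ℕ → List ℕ → List ℕ
newSums ks xs = pairwiseSums xs ++ crossSums ks xs

pairwiseSums-↭ : ∀ {xs ys} → xs ↭ ys → pairwiseSums xs ↭ pairwiseSums ys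
pairwiseSums-↭ refl                      = refl
pairwiseSums-↭ (prep x p)                = ++⁺ (map⁺ (x +_) p) (pairwiseSums-↭ p)
pairwiseSums-↭ {x ∷ y ∷ xs} (swap x y p) rewrite +-comm x y =
  prep (y + x) (↭-trans (shifts (map (x +_) xs) (map (y +_) xs))
                        (++⁺ (map⁺ (y +_) p) (++⁺ (map⁺ (x +_) p) (pairwiseSums-↭ p))))
pairwiseSums-↭ (↭.trans p q)             = ↭-trans (pairwiseSums-↭ p) (pairwiseSums-↭ q)

pairwiseSums-∷ : ∀ m xs → pairwiseSums (m ∷ xs) ↭ newSums (m ∷ []) xs
pairwiseSums-∷ m xs = ↭-trans (++-comm (map (m +_) xs) (pairwiseSums xs))
                              (++⁺ˡ (pairwiseSums xs) (↭-sym (++-identityʳ (map (m +_) xs))))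

crossSums-[]ʳ : ∀ ks → crossSums ks [] ≡ []
crossSums-[]ʳ []       = refl
crossSums-[]ʳ (k ∷ ks) = crossSums-[]ʳ ks

crossSums-∷ʳ : ∀ ks x xs → crossSums ks (x ∷ xs) ↭ map (_+ x) ks ++ crossSums ks xs
crossSums-∷ʳ []       x xs = refl
crossSums-∷ʳ (k ∷ ks) x xs =
  prep (k + x) (↭-trans (++⁺ˡ (map (k +_) xs) (crossSums-∷ʳ ks x xs))
                        (shifts (map (k +_) xs) (map (_+ x) ks)))

newSums-∷ʳ : ∀ ks x xs → newSums ks (x ∷ xs) ↭ map (_+ x) ks ++ newSums (x ∷ ks) xs
newSums-∷ʳ ks x xs = begin
  (a ++ b) ++ crossSums ks (x ∷ xs)  ↭⟨ ++⁺ˡ (a ++ b) (crossSums-∷ʳ ks x xs) ⟩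
  (a ++ b) ++ (c ++ d)               ↭⟨ ++-assoc a b (c ++ d) ⟩
  a ++ b ++ c ++ d                   ↭⟨ shifts a b ⟩
  b ++ a ++ c ++ d                   ↭⟨ ++⁺ˡ b (shifts a c) ⟩
  b ++ c ++ a ++ d                   ↭⟨ shifts b c ⟩
  c ++ b ++ a ++ d                   ∎
  where
  open PermutationReasoning
  a = map (x +_) xs
  b = pairwiseSums xs
  c = map (_+ x) ks
  d = crossSums ks xs

newSums-∈ : ∀ {k ks x xs} → k ∈ ks → k + x ∈ newSums ks (x ∷ xs)
newSums-∈ {x = x} {xs} k∈ks = ∈-++⁺ʳ (pairwiseSums (x ∷ xs)) (crossSums-∈ k∈ks)
  where
  crossSums-∈ : ∀ {k ks} → k ∈ ks → k + x ∈ crossSums ks (x ∷ xs)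
  crossSums-∈ (here refl)                = here refl
  crossSums-∈ {ks = k ∷ _} (there k∈ks) = ∈-++⁺ʳ (map (k +_) (x ∷ xs)) (crossSums-∈ k∈ks)

map-+-≥ : ∀ {a b k xs} → a ≤ k → All (b ≤_) xs → All (a + b ≤_) (map (k +_) xs)
map-+-≥ a≤k xs≥b = All.map⁺ (All.map (+-mono-≤ a≤k) xs≥b)

pairwiseSums-≥ : ∀ {b xs} → All (b ≤_) xs → All (b + b ≤_) (pairwiseSums xs)
pairwiseSums-≥ []           = []
pairwiseSums-≥ (b≤x ∷ xs≥b) = All.++⁺ (map-+-≥ b≤x xs≥b) (pairwiseSums-≥ xs≥b)

crossSums-≥ : ∀ {a b ks xs} → All (a ≤_) ks → All (b ≤_) xs → All (a + b ≤_) (crossSums ks xs)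
crossSums-≥ []           xs≥b = []
crossSums-≥ (a≤k ∷ ks≥a) xs≥b = All.++⁺ (map-+-≥ a≤k xs≥b) (crossSums-≥ ks≥a xs≥b)

newSums-≥ : ∀ {a b ks xs} → a ≤ b → All (a ≤_) ks → All (b ≤_) xs → All (a + b ≤_) (newSums ks xs)
newSums-≥ {b = b} a≤b ks≥a xs≥b =
  All.++⁺ (All.map (≤-trans (+-monoˡ-≤ b a≤b)) (pairwiseSums-≥ xs≥b)) (crossSums-≥ ks≥a xs≥b)

++-cancelˡ : ∀ {A : Set} (zs : List A) {xs ys} → zs ++ xs ↭ zs ++ ys → xs ↭ ys
++-cancelˡ []       p = p
++-cancelˡ (z ∷ zs) p = ++-cancelˡ zs (drop-∷ p)

∈⇒↭∷ : ∀ {A : Set} {x : A} {xs} → x ∈ xs → ∃ λ xs′ → xs ↭ x ∷ xs′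
∈⇒↭∷ {x = x} x∈xs with as , bs , refl ← ∈-∃++ x∈xs = as ++ bs , shift x as bs

newSums-∷-≄-[] : ∀ {k ks y ys} → k ∈ ks → ¬ (newSums ks (y ∷ ys) ↭ newSums ks [])
newSums-∷-≄-[] {ks = ks} k∈ks p with () ← subst (_ ∈_) (crossSums-[]ʳ ks) (∈-resp-↭ p (newSums-∈ k∈ks))

-- k + x occurs in newSums ks (x ∷ xs), while every element of newSums ks (y ∷ ys) is at least k + y.
newSums-head-≤ : ∀ {k ks x xs y ys} → k ∈ ks → All (k ≤_) ks → k ≤ y → All (y ≤_) ys →
                 newSums ks (x ∷ xs) ↭ newSums ks (y ∷ ys) → y ≤ x
newSums-head-≤ {k} {x = x} {y = y} k∈ks ks≥k k≤y ys≥y p =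
  +-cancelˡ-≤ k y x (All.lookup (newSums-≥ k≤y ks≥k (≤-refl ∷ ys≥y)) (∈-resp-↭ p (newSums-∈ k∈ks)))

newSums-injective : ∀ {k ks xs ys} → k ∈ ks → All (k ≤_) ks → All (k ≤_) xs → All (k ≤_) ys →
                    AllPairs _≤_ xs → AllPairs _≤_ ys → newSums ks xs ↭ newSums ks ys → xs ≡ ys
newSums-injective {xs = []}    {[]}    _    _ _ _ _ _ _ = refl
newSums-injective {xs = []}    {_ ∷ _} k∈ks _ _ _ _ _ p = contradiction (↭-sym p) (newSums-∷-≄-[] k∈ks)
newSums-injective {xs = _ ∷ _} {[]}    k∈ks _ _ _ _ _ p = contradiction p (newSums-∷-≄-[] k∈ks)
newSums-injective {ks = ks} {x ∷ xs} {y ∷ ys}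
  k∈ks ks≥k (k≤x ∷ xs≥k) (k≤y ∷ ys≥k) (xs≥x ∷ xs↗) (ys≥y ∷ ys↗) p
  with refl ← ≤-antisym (newSums-head-≤ k∈ks ks≥k k≤y ys≥y p)
                        (newSums-head-≤ k∈ks ks≥k k≤x xs≥x (↭-sym p)) =
  cong (x ∷_) (newSums-injective (there k∈ks) (k≤x ∷ ks≥k) xs≥k ys≥k xs↗ ys↗ p′)
  where
  p′ : newSums (x ∷ ks) xs ↭ newSums (x ∷ ks) ys
  p′ = ++-cancelˡ (map (_+ x) ks)
         (↭-trans (↭-sym (newSums-∷ʳ ks x xs)) (↭-trans p (newSums-∷ʳ ks x ys)))

pairwiseSums-injective : ∀ {m xs ys} → m ∈ xs → m ∈ ys → All (m ≤_) xs → All (m ≤_) ys →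
                         pairwiseSums xs ↭ pairwiseSums ys → xs ↭ ys
pairwiseSums-injective {m} {xs} {ys} m∈xs m∈ys xs≥m ys≥m p
  with xs′ , xs↭ ← ∈⇒↭∷ m∈xs | ys′ , ys↭ ← ∈⇒↭∷ m∈ys = begin
  xs            ↭⟨ sort-↭∷ xs↭ ⟨
  m ∷ sort xs′  ≡⟨ cong (m ∷_) sorted-equal ⟩
  m ∷ sort ys′  ↭⟨ sort-↭∷ ys↭ ⟩
  ys            ∎
  where
  open PermutationReasoning
  sort-↭∷ : ∀ {zs zs′} → zs ↭ m ∷ zs′ → m ∷ sort zs′ ↭ zs
  sort-↭∷ zs↭ = ↭-trans (prep m (sort-↭ _)) (↭-sym zs↭)
  sort-≥ : ∀ {zs zs′} → zs ↭ m ∷ zs′ → All (m ≤_) zs → All (m ≤_) (sort zs′)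
  sort-≥ zs↭ zs≥m with _ ∷ zs′≥m ← All-resp-↭ zs↭ zs≥m = All-resp-↭ (↭-sym (sort-↭ _)) zs′≥m
  sorted-equal : sort xs′ ≡ sort ys′
  sorted-equal = newSums-injective (here refl) (≤-refl ∷ []) (sort-≥ xs↭ xs≥m) (sort-≥ ys↭ ys≥m)
    (Linked⇒AllPairs ≤-trans (sort-↗ xs′)) (Linked⇒AllPairs ≤-trans (sort-↗ ys′)) (begin
      newSums (m ∷ []) (sort xs′)  ↭⟨ pairwiseSums-∷ m (sort xs′) ⟨
      pairwiseSums (m ∷ sort xs′)  ↭⟨ pairwiseSums-↭ (sort-↭∷ xs↭) ⟩
      pairwiseSums xs              ↭⟨ p ⟩
      pairwiseSums ys              ↭⟨ pairwiseSums-↭ (sort-↭∷ ys↭) ⟨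
      pairwiseSums (m ∷ sort ys′)  ↭⟨ pairwiseSums-∷ m (sort ys′) ⟩
      newSums (m ∷ []) (sort ys′)  ∎)

+-interchange : ∀ a b c d → (a + b) + (c + d) ≡ (a + c) + (b + d)
+-interchange = interchange

<ᵇ≡true⇒< : ∀ a b → (a <ᵇ b) ≡ true → a < b
<ᵇ≡true⇒< a b eq = <ᵇ⇒< a b (subst T (sym eq) tt)

<ᵇ≡false⇒≮ : ∀ a b → (a <ᵇ b) ≡ false → ¬ a < b
<ᵇ≡false⇒≮ a b eq a<b = subst T eq (<⇒<ᵇ a<b)

boolToℕ : Bool → ℕ
boolToℕ false = 0
boolToℕ true  = 1

boolToℕ-T : ∀ {b} → T b → boolToℕ b ≡ 1
boolToℕ-T {true} _ = refl

module _ {A : Set} where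

  count-∷ : ∀ (p : A → Bool) x xs → count p (x ∷ xs) ≡ boolToℕ (p x) + count p xs
  count-∷ p x xs with p x
  ... | true  = refl
  ... | false = refl

  count-++ : ∀ (p : A → Bool) xs ys → count p (xs ++ ys) ≡ count p xs + count p ys
  count-++ p xs ys = trans (cong length (filter-++ _ xs ys)) (length-++ (filterᵇ p xs))

  count-cong : ∀ {p q : A → Bool} → (∀ x → p x ≡ q x) → ∀ xs → count p xs ≡ count q xs
  count-cong         p≗q []       = refl
  count-cong {p} {q} p≗q (x ∷ xs) = begin
    count p (x ∷ xs)            ≡⟨ count-∷ p x xs ⟩
    boolToℕ (p x) + count p xs  ≡⟨ cong₂ _+_ (cong boolToℕ (p≗q x)) (count-cong p≗q xs) ⟩
    boolToℕ (q x) + count q xs  ≡⟨ count-∷ q x xs ⟨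
    count q (x ∷ xs)            ∎
    where open ≡-Reasoning

  count-∧-xor : ∀ (p q : A → Bool) xs →
                2 * count (λ x → p x ∧ q x) xs + count (λ x → p x xor q x) xs ≡ count p xs + count q xs
  count-∧-xor p q []       = refl
  count-∧-xor p q (x ∷ xs) = begin
    2 * count p∧q (x ∷ xs) + count p⊕q (x ∷ xs)
      ≡⟨ cong₂ (λ m m′ → 2 * m + m′) (count-∷ p∧q x xs) (count-∷ p⊕q x xs) ⟩
    2 * (a + a′) + (b + b′)              ≡⟨ cong (_+ (b + b′)) (*-distribˡ-+ 2 a a′) ⟩
    (2 * a + 2 * a′) + (b + b′)          ≡⟨ +-interchange (2 * a) (2 * a′) b b′ ⟩
    (2 * a + b) + (2 * a′ + b′)          ≡⟨ cong₂ _+_ (pointwise (p x) (q x)) (count-∧-xor p q xs) ⟩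
    (c + d) + (c′ + d′)                  ≡⟨ +-interchange c d c′ d′ ⟩
    (c + c′) + (d + d′)                  ≡⟨ cong₂ _+_ (count-∷ p x xs) (count-∷ q x xs) ⟨
    count p (x ∷ xs) + count q (x ∷ xs)  ∎
    where
    open ≡-Reasoning
    p∧q p⊕q : A → Bool
    p∧q x = p x ∧ q x
    p⊕q x = p x xor q x
    a b c d a′ b′ c′ d′ : ℕ
    a  = boolToℕ (p∧q x)
    b  = boolToℕ (p⊕q x)
    c  = boolToℕ (p x)
    d  = boolToℕ (q x)
    a′ = count p∧q xs
    b′ = count p⊕q xs
    c′ = count p xs
    d′ = count q xs
    pointwise : ∀ u v → 2 * boolToℕ (u ∧ v) + boolToℕ (u xor v) ≡ boolToℕ u + boolToℕ v
    pointwise false false = refl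
    pointwise false true  = refl
    pointwise true  false = refl
    pointwise true  true  = refl

  count-∨ : ∀ (p q : A → Bool) → (∀ x → p x ∧ q x ≡ false) →
            ∀ xs → count (λ x → p x ∨ q x) xs ≡ count p xs + count q xs
  count-∨ p q disjoint []       = refl
  count-∨ p q disjoint (x ∷ xs) = begin
    count p∨q (x ∷ xs)                       ≡⟨ count-∷ p∨q x xs ⟩
    boolToℕ (p x ∨ q x) + count p∨q xs
      ≡⟨ cong₂ _+_ (pointwise (p x) (q x) (disjoint x)) (count-∨ p q disjoint xs) ⟩
    (c + d) + (count p xs + count q xs)      ≡⟨ +-interchange c d (count p xs) (count q xs) ⟩
    (c + count p xs) + (d + count q xs)      ≡⟨ cong₂ _+_ (count-∷ p x xs) (count-∷ q x xs) ⟨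
    count p (x ∷ xs) + count q (x ∷ xs)      ∎
    where
    open ≡-Reasoning
    p∨q : A → Bool
    p∨q x = p x ∨ q x
    c d : ℕ
    c = boolToℕ (p x)
    d = boolToℕ (q x)
    pointwise : ∀ u v → u ∧ v ≡ false → boolToℕ (u ∨ v) ≡ boolToℕ u + boolToℕ v
    pointwise false v     _ = refl
    pointwise true  false _ = refl

  count-concatMap-tabulate : ∀ {B : Set} {n} (p : A → Bool) (f : B → List A) (g : Fin n → B) →
                             count p (concatMap f (tabulate g)) ≡ ∑[ i < n ] count p (f (g i))
  count-concatMap-tabulate {n = zero}  p f g = refl
  count-concatMap-tabulate {n = suc n} p f g =
    trans (count-++ p (f (g zero)) _) (cong (count p (f (g zero)) +_) (count-concatMap-tabulate p f (g ∘ suc)))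

  count-if : ∀ (p : A → Bool) b x → count p (if b then x ∷ [] else []) ≡ boolToℕ (b ∧ p x)
  count-if p false x = refl
  count-if p true  x with p x
  ... | true  = refl
  ... | false = refl

∑-zero : ∀ {n} (f : Fin n → ℕ) → (∀ i → f i ≡ 0) → ∑[ i < n ] f i ≡ 0
∑-zero {n} f f≗0 = trans (sum-cong-≗ f≗0) (sum-replicate-zero n)

∑-≥-term : ∀ {n} (f : Fin n → ℕ) i → f i ≤ ∑[ j < n ] f j
∑-≥-term {suc n} f i = subst (f i ≤_) (sym (sum-remove {i = i} f)) (m≤m+n (f i) _)

∑-boolToℕ-≤1 : ∀ {n} (f : Fin n → Bool) → (∀ {i j} → T (f i) → T (f j) → i ≡ j) →
               ∑[ i < n ] boolToℕ (f i) ≤ 1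
∑-boolToℕ-≤1 {zero}  f unique = z≤n
∑-boolToℕ-≤1 {suc n} f unique with f zero in f0
... | true  = ≤-reflexive (cong suc (∑-zero _ others))
  where
  others : ∀ i → boolToℕ (f (suc i)) ≡ 0
  others i with f (suc i) in fi
  ... | true  with () ← unique (subst T (sym f0) tt) (subst T (sym fi) tt)
  ... | false = refl
... | false = ∑-boolToℕ-≤1 (f ∘ suc) (λ fi fj → suc-injective (unique fi fj))

lookup-⁅⁆ : ∀ {n} (u v : Fin n) → lookup ⁅ v ⁆ u ≡ true → u ≡ v
lookup-⁅⁆ u v eq = x∈⁅y⁆⇒x≡y v (lookup⇒[]= u ⁅ v ⁆ eq)

∑-select : ∀ {n} (f : Fin n → Bool) v → ∑[ u < n ] boolToℕ (f u ∧ lookup ⁅ v ⁆ u) ≡ boolToℕ (f v)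
∑-select f zero rewrite ∧-identityʳ (f zero) =
  trans (cong (boolToℕ (f zero) +_) (∑-zero _ outside)) (+-identityʳ _)
  where
  outside : ∀ u → boolToℕ (f (suc u) ∧ lookup Data.Fin.Subset.⊥ u) ≡ 0
  outside u rewrite lookup-replicate u false | ∧-zeroʳ (f (suc u)) = refl
∑-select f (suc v) rewrite ∧-zeroʳ (f zero) = ∑-select (f ∘ suc) v

-- Degrees

module _ {n} (G : Graph n) where

  isEdge : Fin n → Fin n → Bool
  isEdge u w = (toℕ u <ᵇ toℕ w) ∧ adj G u w

  count-edges : ∀ (p : Fin n × Fin n → Bool) →
                count p (edges G) ≡ ∑[ u < n ] ∑[ w < n ] boolToℕ (isEdge u w ∧ p (u , w))
  count-edges p = trans (count-concatMap-tabulate p row id)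
    (sum-cong-≗ λ u → trans (count-concatMap-tabulate p (entry u) id)
      (sum-cong-≗ λ w → count-if p (isEdge u w) (u , w)))
    where
    entry : Fin n → Fin n → List (Fin n × Fin n)
    entry u w = if isEdge u w then (u , w) ∷ [] else []
    row : Fin n → List (Fin n × Fin n)
    row u = concatMap (entry u) (allFin n)

  isEdge-irrefl : ∀ u → isEdge u u ≡ false
  isEdge-irrefl u rewrite irrefl G u = ∧-zeroʳ _

  isEdge-either : ∀ v w → boolToℕ (isEdge v w) + boolToℕ (isEdge w v) ≡ boolToℕ (adj G v w)
  isEdge-either v w with toℕ v <ᵇ toℕ w in v<w | toℕ w <ᵇ toℕ v in w<v
  ... | true  | true  = contradiction (<ᵇ≡true⇒< _ _ w<v) (<-asym (<ᵇ≡true⇒< (toℕ v) (toℕ w) v<w))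
  ... | true  | false = +-identityʳ _
  ... | false | true  = cong boolToℕ (Graph.sym G w v)
  ... | false | false
    with refl ← toℕ-injective {i = v} {w} (≤-antisym (≮⇒≥ (<ᵇ≡false⇒≮ (toℕ w) (toℕ v) w<v))
                                                     (≮⇒≥ (<ᵇ≡false⇒≮ (toℕ v) (toℕ w) v<w))) =
    cong boolToℕ (sym (irrefl G v))

  degree : Fin n → ℕ
  degree v = ext G ⁅ v ⁆

  incidences : Subset n → (Fin n × Fin n → Fin n) → ℕ
  incidences X end = count (lookup X ∘ end) (edges G)

  degreeSum : Subset n → ℕ
  degreeSum X = incidences X proj₁ + incidences X proj₂

  handshake : ∀ X → 2 * int G X + ext G X ≡ degreeSum X
  handshake X = count-∧-xor (lookup X ∘ proj₁) (lookup X ∘ proj₂) (edges G)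

  int-⁅⁆ : ∀ v → int G ⁅ v ⁆ ≡ 0
  int-⁅⁆ v = trans (count-edges _) (∑-zero _ λ u → ∑-zero _ λ w → noLoop u w)
    where
    noLoop : ∀ u w → boolToℕ (isEdge u w ∧ (lookup ⁅ v ⁆ u ∧ lookup ⁅ v ⁆ w)) ≡ 0
    noLoop u w with lookup ⁅ v ⁆ u in u∈ | lookup ⁅ v ⁆ w in w∈
    ... | true  | true  with refl ← lookup-⁅⁆ u v u∈ | refl ← lookup-⁅⁆ w v w∈ rewrite isEdge-irrefl u = refl
    ... | true  | false rewrite ∧-zeroʳ (isEdge u w) = refl
    ... | false | _     rewrite ∧-zeroʳ (isEdge u w) = refl

  degree≡degreeSum : ∀ v → degree v ≡ degreeSum ⁅ v ⁆
  degree≡degreeSum v = trans (cong (λ i → 2 * i + degree v) (sym (int-⁅⁆ v))) (handshake ⁅ v ⁆)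

  degreeSum-∪ : ∀ X Y → (∀ u → lookup X u ∧ lookup Y u ≡ false) →
                degreeSum (X ∪ Y) ≡ degreeSum X + degreeSum Y
  degreeSum-∪ X Y disjoint = trans (cong₂ _+_ (incidences-∪ proj₁) (incidences-∪ proj₂))
    (+-interchange (incidences X proj₁) (incidences Y proj₁) (incidences X proj₂) (incidences Y proj₂))
    where
    incidences-∪ : ∀ end → incidences (X ∪ Y) end ≡ incidences X end + incidences Y end
    incidences-∪ end = trans (count-cong (λ e → lookup-zipWith _∨_ (end e) X Y) (edges G))
                             (count-∨ (lookup X ∘ end) (lookup Y ∘ end) (disjoint ∘ end) (edges G))

  degree-pair : ∀ {i j} → i ≢ j →
                2 * int G (⁅ i ⁆ ∪ ⁅ j ⁆) + ext G (⁅ i ⁆ ∪ ⁅ j ⁆) ≡ degree i + degree j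
  degree-pair {i} {j} i≢j = begin
    2 * int G (⁅ i ⁆ ∪ ⁅ j ⁆) + ext G (⁅ i ⁆ ∪ ⁅ j ⁆)  ≡⟨ handshake (⁅ i ⁆ ∪ ⁅ j ⁆) ⟩
    degreeSum (⁅ i ⁆ ∪ ⁅ j ⁆)                        ≡⟨ degreeSum-∪ ⁅ i ⁆ ⁅ j ⁆ disjoint ⟩
    degreeSum ⁅ i ⁆ + degreeSum ⁅ j ⁆
      ≡⟨ cong₂ _+_ (degree≡degreeSum i) (degree≡degreeSum j) ⟨
    degree i + degree j                              ∎
    where
    open ≡-Reasoning
    disjoint : ∀ u → lookup ⁅ i ⁆ u ∧ lookup ⁅ j ⁆ u ≡ false
    disjoint u with lookup ⁅ i ⁆ u in u∈i | lookup ⁅ j ⁆ u in u∈j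
    ... | true  | true  = contradiction (trans (sym (lookup-⁅⁆ u i u∈i)) (lookup-⁅⁆ u j u∈j)) i≢j
    ... | true  | false = refl
    ... | false | _     = refl

  degree≡neighbours : ∀ v → degree v ≡ ∑[ w < n ] boolToℕ (adj G v w)
  degree≡neighbours v = begin
    degree v
      ≡⟨ degree≡degreeSum v ⟩
    incidences ⁅ v ⁆ proj₁ + incidences ⁅ v ⁆ proj₂
      ≡⟨ cong₂ _+_ (count-edges _) (count-edges _) ⟩
    ∑[ u < n ] ∑[ w < n ] starts u w + ∑[ u < n ] ∑[ w < n ] ends u w
      ≡⟨ cong (_+ ∑[ u < n ] ∑[ w < n ] ends u w) (∑-comm starts) ⟩
    ∑[ w < n ] ∑[ u < n ] starts u w + ∑[ u < n ] ∑[ w < n ] ends u w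
      ≡⟨ cong₂ _+_ (sum-cong-≗ λ w → ∑-select (λ u → isEdge u w) v) (sum-cong-≗ λ u → ∑-select (isEdge u) v) ⟩
    ∑[ w < n ] boolToℕ (isEdge v w) + ∑[ w < n ] boolToℕ (isEdge w v)
      ≡⟨ ∑-distrib-+ (λ w → boolToℕ (isEdge v w)) (λ w → boolToℕ (isEdge w v)) ⟨
    ∑[ w < n ] (boolToℕ (isEdge v w) + boolToℕ (isEdge w v))
      ≡⟨ sum-cong-≗ (isEdge-either v) ⟩
    ∑[ w < n ] boolToℕ (adj G v w)
      ∎
    where
    open ≡-Reasoning
    starts ends : Fin n → Fin n → ℕ
    starts u w = boolToℕ (isEdge u w ∧ lookup ⁅ v ⁆ u)
    ends   u w = boolToℕ (isEdge u w ∧ lookup ⁅ v ⁆ w)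

-- Subsets of size one and two

pairs : ∀ {A : Set} → List A → List (A × A)
pairs []       = []
pairs (x ∷ xs) = map (x ,_) xs ++ pairs xs

pairs-map : ∀ {A B : Set} (f : A → B) xs → pairs (map f xs) ≡ map (Product.map f f) (pairs xs)
pairs-map f []       = refl
pairs-map f (x ∷ xs) = begin
  map (f x ,_) (map f xs) ++ pairs (map f xs)          ≡⟨ cong₂ _++_ (sym (map-∘ xs)) (pairs-map f xs) ⟩
  map (λ y → f x , f y) xs ++ map f² (pairs xs)        ≡⟨ cong (_++ map f² (pairs xs)) (map-∘ xs) ⟩
  map f² (map (x ,_) xs) ++ map f² (pairs xs)          ≡⟨ map-++ f² (map (x ,_) xs) (pairs xs) ⟨
  map f² (pairs (x ∷ xs))                              ∎
  where
  open ≡-Reasoning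
  f² = Product.map f f

pairs-All : ∀ {A : Set} {R : A → A → Set} {xs} →
            AllPairs R xs → All (λ p → R (proj₁ p) (proj₂ p)) (pairs xs)
pairs-All []         = []
pairs-All (Rx ∷ Rxs) = All.++⁺ (All.map⁺ Rx) (pairs-All Rxs)

pairwiseSums-pairs : ∀ {A : Set} (d : A → ℕ) xs →
                     pairwiseSums (map d xs) ≡ map (λ p → d (proj₁ p) + d (proj₂ p)) (pairs xs)
pairwiseSums-pairs d []       = refl
pairwiseSums-pairs d (x ∷ xs) = begin
  map (d x +_) (map d xs) ++ pairwiseSums (map d xs)  ≡⟨ cong₂ _++_ (sym (map-∘ xs)) (pairwiseSums-pairs d xs) ⟩
  map (λ y → d x + d y) xs ++ map d² (pairs xs)       ≡⟨ cong (_++ map d² (pairs xs)) (map-∘ xs) ⟩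
  map d² (map (x ,_) xs) ++ map d² (pairs xs)         ≡⟨ map-++ d² (map (x ,_) xs) (pairs xs) ⟨
  map d² (pairs (x ∷ xs))                             ∎
  where
  open ≡-Reasoning
  d² : _ × _ → ℕ
  d² p = d (proj₁ p) + d (proj₂ p)

allFin-suc : ∀ n → allFin (suc n) ≡ zero ∷ map suc (allFin n)
allFin-suc n = cong (zero ∷_) (sym (map-tabulate id suc))

filterᵇ-map : ∀ {A B : Set} (p : B → Bool) (f : A → B) xs →
              filterᵇ p (map f xs) ≡ map f (filterᵇ (p ∘ f) xs)
filterᵇ-map p f []       = refl
filterᵇ-map p f (x ∷ xs) with p (f x)
... | true  = cong (f x ∷_) (filterᵇ-map p f xs)
... | false = filterᵇ-map p f xs

subsetsOfSize : ℕ → (n : ℕ) → List (Subset n)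
subsetsOfSize k n = filterᵇ (λ X → ∣ X ∣ ≡ᵇ k) (allSubsets n)

subsetsOfSize-suc : ∀ k n → subsetsOfSize k (suc n) ≡
  map (false ∷_) (subsetsOfSize k n) ++ map (true ∷_) (filterᵇ (λ X → suc ∣ X ∣ ≡ᵇ k) (allSubsets n))
subsetsOfSize-suc k n = trans (filter-++ _ (map (false ∷_) (allSubsets n)) _)
  (cong₂ _++_ (filterᵇ-map _ (false ∷_) (allSubsets n)) (filterᵇ-map _ (true ∷_) (allSubsets n)))

subsetsOfSize-0 : ∀ n → subsetsOfSize 0 n ≡ Data.Fin.Subset.⊥ ∷ []
subsetsOfSize-0 zero    = refl
subsetsOfSize-0 (suc n) rewrite subsetsOfSize-suc 0 n | subsetsOfSize-0 n
  | filter-none (T? ∘ λ (_ : Subset n) → false) (All.universal (λ _ ()) (allSubsets n)) = refl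

subsetsOfSize-1 : ∀ n → subsetsOfSize 1 n ↭ map ⁅_⁆ (allFin n)
subsetsOfSize-1 zero    = ↭-refl
subsetsOfSize-1 (suc n) = begin
  subsetsOfSize 1 (suc n)                                ≡⟨ subsetsOfSize-suc 1 n ⟩
  map (false ∷_) (subsetsOfSize 1 n) ++ map (true ∷_) (subsetsOfSize 0 n)
    ↭⟨ ++⁺ (map⁺ (false ∷_) (subsetsOfSize-1 n)) (↭-reflexive (cong (map (true ∷_)) (subsetsOfSize-0 n))) ⟩
  map (false ∷_) (map ⁅_⁆ vs) ++ ⁅ zero ⁆ ∷ []           ↭⟨ ++-comm (map (false ∷_) (map ⁅_⁆ vs)) _ ⟩
  ⁅ zero ⁆ ∷ map (false ∷_) (map ⁅_⁆ vs)
    ≡⟨ cong (⁅ zero ⁆ ∷_) (trans (sym (map-∘ vs)) (map-∘ vs)) ⟨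
  map ⁅_⁆ (zero ∷ map suc vs)                            ≡⟨ cong (map ⁅_⁆) (allFin-suc n) ⟨
  map ⁅_⁆ (allFin (suc n))                               ∎
  where
  open PermutationReasoning
  vs = allFin n

⁅_⁆₂ : ∀ {n} → Fin n × Fin n → Subset n
⁅ i , j ⁆₂ = ⁅ i ⁆ ∪ ⁅ j ⁆

⁅zero,suc⁆₂ : ∀ {n} (j : Fin n) → ⁅ zero , suc j ⁆₂ ≡ true ∷ ⁅ j ⁆
⁅zero,suc⁆₂ j = cong (true ∷_) (∪-identityˡ ⁅ j ⁆)

subsetsOfSize-2 : ∀ n → subsetsOfSize 2 n ↭ map ⁅_⁆₂ (pairs (allFin n))
subsetsOfSize-2 zero    = ↭-refl
subsetsOfSize-2 (suc n) = begin
  subsetsOfSize 2 (suc n)                                       ≡⟨ subsetsOfSize-suc 2 n ⟩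
  map (false ∷_) (subsetsOfSize 2 n) ++ map (true ∷_) (subsetsOfSize 1 n)
    ↭⟨ ++⁺ (map⁺ (false ∷_) (subsetsOfSize-2 n)) (map⁺ (true ∷_) (subsetsOfSize-1 n)) ⟩
  map (false ∷_) (map ⁅_⁆₂ ps) ++ map (true ∷_) (map ⁅_⁆ vs)    ↭⟨ ++-comm (map (false ∷_) (map ⁅_⁆₂ ps)) _ ⟩
  map (true ∷_) (map ⁅_⁆ vs) ++ map (false ∷_) (map ⁅_⁆₂ ps)    ≡⟨ cong₂ _++_ (map-∘ vs) (map-∘ ps) ⟨
  map (λ j → true ∷ ⁅ j ⁆) vs ++ map (λ p → false ∷ ⁅ p ⁆₂) ps
    ≡⟨ cong (_++ map (λ p → false ∷ ⁅ p ⁆₂) ps) (map-cong ⁅zero,suc⁆₂ vs) ⟨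
  map (λ j → ⁅ zero , suc j ⁆₂) vs ++ map (⁅_⁆₂ ∘ Product.map suc suc) ps
    ≡⟨ cong₂ _++_ (trans (map-∘ vs) (map-∘ (map suc vs)))
                  (trans (map-∘ ps) (cong (map ⁅_⁆₂) (sym (pairs-map suc vs)))) ⟩
  map ⁅_⁆₂ (map (zero ,_) (map suc vs)) ++ map ⁅_⁆₂ (pairs (map suc vs))
    ≡⟨ map-++ ⁅_⁆₂ (map (zero ,_) (map suc vs)) _ ⟨
  map ⁅_⁆₂ (pairs (zero ∷ map suc vs))                          ≡⟨ cong (map ⁅_⁆₂ ∘ pairs) (allFin-suc n) ⟨
  map ⁅_⁆₂ (pairs (allFin (suc n)))                             ∎
  where
  open PermutationReasoning
  vs = allFin n
  ps = pairs vs

module _ {n} (G : Graph n) where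

  degrees : List ℕ
  degrees = map (degree G) (allFin n)

  private
    intExt : Subset n → ℕ × ℕ
    intExt X = int G X , ext G X

  M₁-degrees : M 1 G ↭ map (0 ,_) degrees
  M₁-degrees = begin
    map intExt (subsetsOfSize 1 n)      ↭⟨ map⁺ intExt (subsetsOfSize-1 n) ⟩
    map intExt (map ⁅_⁆ (allFin n))     ≡⟨ map-∘ (allFin n) ⟨
    map (intExt ∘ ⁅_⁆) (allFin n)       ≡⟨ map-cong (λ v → cong (_, degree G v) (int-⁅⁆ G v)) (allFin n) ⟩
    map ((0 ,_) ∘ degree G) (allFin n)  ≡⟨ map-∘ (allFin n) ⟩
    map (0 ,_) degrees                  ∎
    where open PermutationReasoning

  M₂-pairwiseSums : map (λ p → 2 * proj₁ p + proj₂ p) (M 2 G) ↭ pairwiseSums degrees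
  M₂-pairwiseSums = begin
    map weigh (map intExt (subsetsOfSize 2 n))              ↭⟨ map⁺ weigh (map⁺ intExt (subsetsOfSize-2 n)) ⟩
    map weigh (map intExt (map ⁅_⁆₂ ps))                    ≡⟨ trans (map-∘ ps) (map-∘ (map ⁅_⁆₂ ps)) ⟨
    map (weigh ∘ intExt ∘ ⁅_⁆₂) ps
      ≡⟨ map-cong-local (All.map (degree-pair G) (pairs-All (allFin⁺ n))) ⟩
    map (λ p → degree G (proj₁ p) + degree G (proj₂ p)) ps  ≡⟨ pairwiseSums-pairs (degree G) (allFin n) ⟨
    pairwiseSums degrees                                    ∎
    where
    open PermutationReasoning
    ps = pairs (allFin n)
    weigh : ℕ × ℕ → ℕ
    weigh p = 2 * proj₁ p + proj₂ p

-- Leaves of trees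

lookup-injective : ∀ {A : Set} {xs : List A} → Unique xs →
                   ∀ {i j} → List.lookup xs i ≡ List.lookup xs j → i ≡ j
lookup-injective (_ ∷ _)      {zero}  {zero}  _  = refl
lookup-injective (x≢xs ∷ _)   {zero}  {suc j} eq = contradiction eq (All.lookup x≢xs (∈-lookup j))
lookup-injective (x≢xs ∷ _)   {suc i} {zero}  eq = contradiction (sym eq) (All.lookup x≢xs (∈-lookup i))
lookup-injective (_ ∷ unique) {suc i} {suc j} eq = cong suc (lookup-injective unique eq)

Unique⇒length≤ : ∀ {n} {xs : List (Fin n)} → Unique xs → length xs ≤ n
Unique⇒length≤ unique = injective⇒≤ (lookup-injective unique)

AllPairs-++⁻ˡ : ∀ {A : Set} {R : A → A → Set} xs {ys} → AllPairs R (xs ++ ys) → AllPairs R xs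
AllPairs-++⁻ˡ []       _          = []
AllPairs-++⁻ˡ (x ∷ xs) (Rx ∷ Rxs) = All.++⁻ˡ xs Rx ∷ AllPairs-++⁻ˡ xs Rxs

module _ {n} (G : Graph n) where

  adj-sym : ∀ {u w} → Adj G u w → Adj G w u
  adj-sym {u} {w} = subst T (Graph.sym G u w)

  adj-irrefl : ∀ {u} → ¬ Adj G u u
  adj-irrefl {u} = subst T (irrefl G u)

  Chain-∷ʳ : ∀ ws {w ys x} → Chain G (ws ++ w ∷ ys) → Adj G w x → Chain G ((ws ++ w ∷ []) ++ x ∷ [])
  Chain-∷ʳ []            _          w~x = w~x , tt
  Chain-∷ʳ (v ∷ [])      (v~w , _)  w~x = v~w , w~x , tt
  Chain-∷ʳ (v ∷ v′ ∷ ws) (v~v′ , c) w~x = v~v′ , Chain-∷ʳ (v′ ∷ ws) c w~x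

  HasAtMostOneNeighbour : Fin n → Set
  HasAtMostOneNeighbour v = ∀ {w₁ w₂} → Adj G v w₁ → Adj G v w₂ → w₁ ≡ w₂

-- Connected asks for a walk of positive length even from v to itself, so every vertex of a tree
-- has a neighbour (and the one-vertex graph is not a tree).
neighbour : ∀ {n} {G : Graph n} → IsTree G → ∀ v → ∃ (Adj G v)
neighbour {G = G} tree v with IsTree.connected tree v v
... | []    , v~v , _ = ⊥-elim (adj-irrefl G v~v)
... | w ∷ _ , v~w , _ = w , v~w

-- Paths are listed from their current endpoint backwards.
module _ {n} {G : Graph n} (tree : IsTree G) where

  open import Data.List.Membership.DecPropositional (_≟_ {n}) using (_∈?_)

  path-chordless : ∀ {z r rs w} → Unique (z ∷ r ∷ rs) → Chain G (z ∷ r ∷ rs) → Adj G z w → w ∉ rs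
  path-chordless {z} {r} {w = w} unique chain z~w w∈rs with xs , ys , refl ← ∈-∃++ w∈rs =
    IsTree.acyclic tree
      (z , r ∷ xs ++ w ∷ [] , unique′ , length≥2 xs , Chain-∷ʳ G (z ∷ r ∷ xs) chain (adj-sym G z~w))
    where
    unique′ : Unique (z ∷ r ∷ xs ++ w ∷ [])
    unique′ = AllPairs-++⁻ˡ (z ∷ r ∷ xs ++ w ∷ [])
                (subst (λ l → Unique (z ∷ r ∷ l)) (sym (List.++-assoc xs (w ∷ []) ys)) unique)
    length≥2 : ∀ xs → 2 ≤ length (r ∷ xs ++ w ∷ [])
    length≥2 []      = s≤s (s≤s z≤n)
    length≥2 (_ ∷ _) = s≤s (s≤s z≤n)

  closed-path-end : ∀ {z rs} → Unique (z ∷ rs) → Chain G (z ∷ rs) → (∀ {w} → Adj G z w → w ∈ rs) →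
                    HasAtMostOneNeighbour G z
  closed-path-end {rs = []}     _      _     closed z~w₁ _ with () ← closed z~w₁
  closed-path-end {rs = r ∷ rs} unique chain closed z~w₁ z~w₂ =
    trans (predecessor z~w₁) (sym (predecessor z~w₂))
    where
    predecessor : ∀ {w} → Adj G _ w → w ≡ r
    predecessor z~w with closed z~w
    ... | here w≡r   = w≡r
    ... | there w∈rs = contradiction w∈rs (path-chordless unique chain z~w)

  -- Extend the path by an unvisited neighbour of its endpoint while there is one;
  -- fuel counts the unvisited vertices.
  longest-path-end : ∀ fuel {z rs} → fuel + length (z ∷ rs) ≡ n → Unique (z ∷ rs) → Chain G (z ∷ rs) →
                     ∃ (HasAtMostOneNeighbour G)
  longest-path-end fuel {z} {rs} len unique chain
    with any? (λ w → T? (adj G z w) ×-dec ¬? (w ∈? (z ∷ rs)))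
  ... | no stuck = z , closed-path-end unique chain closed
    where
    closed : ∀ {w} → Adj G z w → w ∈ rs
    closed {w} z~w with w ∈? (z ∷ rs)
    ... | yes (here w≡z)   = ⊥-elim (adj-irrefl G (subst (Adj G z) w≡z z~w))
    ... | yes (there w∈rs) = w∈rs
    ... | no w∉            = ⊥-elim (stuck (w , z~w , w∉))
  ... | yes (w , z~w , w∉) = extend fuel len
    where
    unique′ : Unique (w ∷ z ∷ rs)
    unique′ = All.¬Any⇒All¬ (z ∷ rs) w∉ ∷ unique
    extend : ∀ fuel → fuel + length (z ∷ rs) ≡ n → ∃ (HasAtMostOneNeighbour G)
    extend zero        len = contradiction (Unique⇒length≤ unique′) (<-irrefl len)
    extend (suc fuel′) len =
      longest-path-end fuel′ (trans (+-suc fuel′ _) len) unique′ (adj-sym G z~w , chain)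

leaf : ∀ {n} {G : Graph n} → IsTree G → ∃ (HasAtMostOneNeighbour G)
leaf {zero}  tree with () ← IsTree.nonempty tree
leaf {suc m} tree = longest-path-end tree m {z = zero} (+-comm m 1) ([] ∷ []) tt

module _ {n} {G : Graph n} (tree : IsTree G) where

  degree-≥1 : ∀ v → 1 ≤ degree G v
  degree-≥1 v with w , v~w ← neighbour tree v =
    subst (1 ≤_) (sym (degree≡neighbours G v))
      (subst (_≤ _) (boolToℕ-T v~w) (∑-≥-term (boolToℕ ∘ adj G v) w))

  degrees-≥1 : All (1 ≤_) (degrees G)
  degrees-≥1 = All.map⁺ (All.universal degree-≥1 (allFin n))

  1∈degrees : 1 ∈ degrees G
  1∈degrees with v , at-most-one ← leaf tree =
    subst (_∈ degrees G) (≤-antisym degree≤1 (degree-≥1 v)) (∈-map⁺ (degree G) (∈-allFin v))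
    where
    degree≤1 : degree G v ≤ 1
    degree≤1 = subst (_≤ 1) (sym (degree≡neighbours G v)) (∑-boolToℕ-≤1 (adj G v) at-most-one)

proposition5p1 : ∀ {n₁ n₂ : ℕ} (T₁ : Graph n₁) (T₂ : Graph n₂) →
    IsTree T₁ → IsTree T₂ → M 2 T₁ ↭ M 2 T₂ → M 1 T₁ ↭ M 1 T₂
proposition5p1 T₁ T₂ tree₁ tree₂ M₂↭ = begin
  M 1 T₁                   ↭⟨ M₁-degrees T₁ ⟩
  map (0 ,_) (degrees T₁)  ↭⟨ map⁺ (0 ,_) degrees↭ ⟩
  map (0 ,_) (degrees T₂)  ↭⟨ M₁-degrees T₂ ⟨
  M 1 T₂                   ∎
  where
  open PermutationReasoning
  weigh : ℕ × ℕ → ℕ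
  weigh p = 2 * proj₁ p + proj₂ p
  degrees↭ : degrees T₁ ↭ degrees T₂
  degrees↭ = pairwiseSums-injective
    (1∈degrees tree₁) (1∈degrees tree₂) (degrees-≥1 tree₁) (degrees-≥1 tree₂) (begin
      pairwiseSums (degrees T₁)  ↭⟨ M₂-pairwiseSums T₁ ⟨
      map weigh (M 2 T₁)         ↭⟨ map⁺ weigh M₂↭ ⟩
      map weigh (M 2 T₂)         ↭⟨ M₂-pairwiseSums T₂ ⟩
      pairwiseSums (degrees T₂)  ∎)
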